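{- For every integer $n\ge 2$, $$|L_n|=2g(n-1)+4\bigl(g(n-1)-2g(n-2)\bigr)+1=g(n),$$ where $g(m)=(2^m+1)(2^{m-1}+1)/3$ for $m\ge0$.
   Context: For $n\ge1$, $L_n$ is the set of words $a=a_1a_2\cdots a_n$ of length $n$ over the alphabet $\{1,2,3,4\}$ such that $0<a_i\le\max_{0\le j<i}a_j+1$ for every $i\in\{1,\dots,n\}$, with the convention $a_0=1$ (i.e. the word $1a_1\cdots a_n$ with its forced leading letter $1$ dropped satisfies the restricted-growth condition). -}

module Defs where

open import Data.Nat using (ℕ; zero; suc; _+_; _*_; _^_; _≤_; _≤?_; _/_)
open import Data.Fin using (Fin; toℕ)
open import Data.Vec using (Vec; []; _∷_)
open import Data.List using (List; []; _∷_; length; filter; concatMap; map)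
open import Data.List as L using (allFin)
open import Data.Product using (_×_; _,_)
open import Data.Unit using (⊤)
open import Relation.Nullary using (Dec; yes; no)
open import Relation.Nullary.Decidable using (_×-dec_)

letter : Fin 4 → ℕ
letter x = suc (toℕ x)

-- RG m w : the word w satisfies the restricted-growth condition given that
-- the maximum of the previous letters (including a₀ = 1) is m.
RG : ℕ → {n : ℕ} → Vec (Fin 4) n → Set
RG m [] = ⊤
RG m (x ∷ w) = (letter x ≤ suc m) × RG (m Data.Nat.⊔ letter x) w

RG? : (m : ℕ) → {n : ℕ} → (w : Vec (Fin 4) n) → Dec (RG m w)
RG? m [] = yes _
RG? m (x ∷ w) = (letter x ≤? suc m) ×-dec RG? (m Data.Nat.⊔ letter x) w

InL : {n : ℕ} → Vec (Fin 4) n → Set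
InL w = RG 1 w

InL? : {n : ℕ} → (w : Vec (Fin 4) n) → Dec (InL w)
InL? w = RG? 1 w

allWords : (n : ℕ) → List (Vec (Fin 4) n)
allWords zero = [] ∷ []
allWords (suc n) = concatMap (λ x → map (x ∷_) (allWords n)) (allFin 4)

cardL : ℕ → ℕ
cardL n = length (filter InL? (allWords n))

-- g(m) = (2^m+1)(2^{m-1}+1)/3 = (2^m+1)(2^m+2)/6  (exact division)
g : ℕ → ℕ
g m = ((2 ^ m + 1) * (2 ^ m + 2)) / 6

-- Count restricted-growth words by the running maximum m of their prefix.  Once
-- m ≥ 3 every letter of {1,2,3,4} is admissible, so there are 4ⁿ continuations;
-- from m = 2 a word either stays at maximum 2 (two letters) or jumps to 3, and
-- from m = 1 it stays at 1 or jumps to 2.  Solving these linear recurrences gives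
-- 6·|L_n| = (2ⁿ + 1)(2ⁿ + 2), i.e. |L_n| = g(n), which also shows that the division
-- in g is exact.  The stated formula is then g(k+2) + 8g(k) = 6g(k+1) + 1, a
-- polynomial identity in 2ᵏ.
module Submission where

open import Defs
open import Data.Nat using (ℕ; _≤_)
open import Data.Integer using (ℤ; +_; _+_; _*_; _-_)
open import Data.Product using (_×_)
open import Relation.Binary.PropositionalEquality using (_≡_)

import Data.Nat as ℕ
open import Data.Nat using (zero; suc; s≤s; _≤?_; _⊔_; _^_)
open import Data.Nat.Properties using (≤-refl; ≤-trans; m≤m⊔n; *-comm; *-cancelˡ-≡)
open import Data.Nat.DivMod using (m*n/n≡m)
open import Data.Nat.ListAction using (sum)
open import Data.Nat.Tactic.RingSolver using (solve-∀)
open import Data.Integer.Properties using (pos-+; pos-*)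
import Data.Integer.Tactic.RingSolver as ℤ-Solver
open import Data.Fin using (Fin)
open import Data.Fin.Properties using (toℕ<n)
open import Data.Vec using (Vec; _∷_)
open import Data.List using (List; []; _∷_; _++_; length; filter; map; concatMap; allFin)
open import Data.List.Properties using (filter-++; length-++; map-cong)
open import Data.Bool using (true; false; if_then_else_)
open import Data.Product using (_,_)
open import Relation.Nullary using (does)
open import Relation.Nullary.Decidable using (dec-true)
open import Relation.Binary.PropositionalEquality using (refl; cong; cong₂; sym; trans; module ≡-Reasoning)

open ≡-Reasoning

countRG : ℕ → ℕ → ℕ
countRG m n = length (filter (RG? m) (allWords n))

continuations : ℕ → ℕ → Fin 4 → ℕ
continuations m n x = if does (letter x ≤? suc m) then countRG (m ⊔ letter x) n else 0

length-filter-RG?-map-∷ : ∀ m x {n} (ws : List (Vec (Fin 4) n)) →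
  length (filter (RG? m) (map (x ∷_) ws)) ≡
  (if does (letter x ≤? suc m) then length (filter (RG? (m ⊔ letter x)) ws) else 0)
length-filter-RG?-map-∷ m x [] with does (letter x ≤? suc m)
... | true  = refl
... | false = refl
length-filter-RG?-map-∷ m x (w ∷ ws) with does (letter x ≤? suc m) | length-filter-RG?-map-∷ m x ws
... | false | ih = ih
... | true  | ih with does (RG? (m ⊔ letter x) w)
...   | true  = cong suc ih
...   | false = ih

length-filter-RG?-concatMap : ∀ m n (xs : List (Fin 4)) →
  length (filter (RG? m) (concatMap (λ x → map (x ∷_) (allWords n)) xs))
    ≡ sum (map (continuations m n) xs)
length-filter-RG?-concatMap m n [] = refl
length-filter-RG?-concatMap m n (x ∷ xs) = begin
    length (filter (RG? m) (words x ++ concatMap words xs))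
  ≡⟨ cong length (filter-++ (RG? m) (words x) (concatMap words xs)) ⟩
    length (filter (RG? m) (words x) ++ filter (RG? m) (concatMap words xs))
  ≡⟨ length-++ (filter (RG? m) (words x)) ⟩
    length (filter (RG? m) (words x)) ℕ.+ length (filter (RG? m) (concatMap words xs))
  ≡⟨ cong₂ ℕ._+_ (length-filter-RG?-map-∷ m x (allWords n)) (length-filter-RG?-concatMap m n xs) ⟩
    continuations m n x ℕ.+ sum (map (continuations m n) xs) ∎
  where
  words : Fin 4 → List (Vec (Fin 4) (suc n))
  words x = map (x ∷_) (allWords n)

countRG-suc : ∀ m n → countRG m (suc n) ≡ sum (map (continuations m n) (allFin 4))
countRG-suc m n = length-filter-RG?-concatMap m n (allFin 4)

countRG-saturated : ∀ {m} → 3 ≤ m → ∀ n → countRG m n ≡ 4 ^ n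
countRG-saturated 3≤m zero = refl
countRG-saturated {m} 3≤m (suc n) = begin
    countRG m (suc n)
  ≡⟨ countRG-suc m n ⟩
    sum (map (continuations m n) (allFin 4))
  ≡⟨ cong sum (map-cong continuations≡4^n (allFin 4)) ⟩
    sum (map (λ _ → 4 ^ n) (allFin 4))
  ≡⟨⟩
    4 ^ suc n ∎
  where
  continuations≡4^n : ∀ x → continuations m n x ≡ 4 ^ n
  continuations≡4^n x
    rewrite dec-true (letter x ≤? suc m) (≤-trans (toℕ<n x) (s≤s 3≤m))
    = countRG-saturated (≤-trans 3≤m (m≤m⊔n m (letter x))) n

4^n≡2^n*2^n : ∀ n → 4 ^ n ≡ 2 ^ n ℕ.* 2 ^ n
4^n≡2^n*2^n zero = refl
4^n≡2^n*2^n (suc n) = trans (cong (4 ℕ.*_) (4^n≡2^n*2^n n)) (square-double (2 ^ n))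
  where
  square-double : ∀ y → 4 ℕ.* (y ℕ.* y) ≡ 2 ℕ.* y ℕ.* (2 ℕ.* y)
  square-double = solve-∀

2*countRG-2 : ∀ n → 2 ℕ.* countRG 2 n ≡ 4 ^ n ℕ.+ 2 ^ n
2*countRG-2 zero = refl
2*countRG-2 (suc n) = begin
    2 ℕ.* countRG 2 (suc n)
  ≡⟨ cong (2 ℕ.*_) (countRG-suc 2 n) ⟩
    2 ℕ.* (countRG 2 n ℕ.+ (countRG 2 n ℕ.+ (countRG 3 n ℕ.+ (0 ℕ.+ 0))))
  ≡⟨ regroup (countRG 2 n) (countRG 3 n) ⟩
    2 ℕ.* (2 ℕ.* countRG 2 n) ℕ.+ 2 ℕ.* countRG 3 n
  ≡⟨ cong₂ (λ a b → 2 ℕ.* a ℕ.+ 2 ℕ.* b) (2*countRG-2 n) (countRG-saturated ≤-refl n) ⟩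
    2 ℕ.* (4 ^ n ℕ.+ 2 ^ n) ℕ.+ 2 ℕ.* 4 ^ n
  ≡⟨ collect (4 ^ n) (2 ^ n) ⟩
    4 ^ suc n ℕ.+ 2 ^ suc n ∎
  where
  regroup : ∀ a b → 2 ℕ.* (a ℕ.+ (a ℕ.+ (b ℕ.+ (0 ℕ.+ 0)))) ≡ 2 ℕ.* (2 ℕ.* a) ℕ.+ 2 ℕ.* b
  regroup = solve-∀
  collect : ∀ p q → 2 ℕ.* (p ℕ.+ q) ℕ.+ 2 ℕ.* p ≡ 4 ℕ.* p ℕ.+ 2 ℕ.* q
  collect = solve-∀

6*countRG-1 : ∀ n → 6 ℕ.* countRG 1 n ≡ (2 ^ n ℕ.+ 1) ℕ.* (2 ^ n ℕ.+ 2)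
6*countRG-1 zero = refl
6*countRG-1 (suc n) = begin
    6 ℕ.* countRG 1 (suc n)
  ≡⟨ cong (6 ℕ.*_) (countRG-suc 1 n) ⟩
    6 ℕ.* (countRG 1 n ℕ.+ (countRG 2 n ℕ.+ (0 ℕ.+ (0 ℕ.+ 0))))
  ≡⟨ regroup (countRG 1 n) (countRG 2 n) ⟩
    6 ℕ.* countRG 1 n ℕ.+ 3 ℕ.* (2 ℕ.* countRG 2 n)
  ≡⟨ cong₂ (λ a b → a ℕ.+ 3 ℕ.* b) (6*countRG-1 n) (2*countRG-2 n) ⟩
    (2 ^ n ℕ.+ 1) ℕ.* (2 ^ n ℕ.+ 2) ℕ.+ 3 ℕ.* (4 ^ n ℕ.+ 2 ^ n)
  ≡⟨ cong (λ p → (2 ^ n ℕ.+ 1) ℕ.* (2 ^ n ℕ.+ 2) ℕ.+ 3 ℕ.* (p ℕ.+ 2 ^ n)) (4^n≡2^n*2^n n) ⟩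
    (2 ^ n ℕ.+ 1) ℕ.* (2 ^ n ℕ.+ 2) ℕ.+ 3 ℕ.* (2 ^ n ℕ.* 2 ^ n ℕ.+ 2 ^ n)
  ≡⟨ collect (2 ^ n) ⟩
    (2 ^ suc n ℕ.+ 1) ℕ.* (2 ^ suc n ℕ.+ 2) ∎
  where
  regroup : ∀ a b → 6 ℕ.* (a ℕ.+ (b ℕ.+ (0 ℕ.+ (0 ℕ.+ 0)))) ≡ 6 ℕ.* a ℕ.+ 3 ℕ.* (2 ℕ.* b)
  regroup = solve-∀
  collect : ∀ y → (y ℕ.+ 1) ℕ.* (y ℕ.+ 2) ℕ.+ 3 ℕ.* (y ℕ.* y ℕ.+ y) ≡ (2 ℕ.* y ℕ.+ 1) ℕ.* (2 ℕ.* y ℕ.+ 2)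
  collect = solve-∀

g≡cardL : ∀ n → g n ≡ cardL n
g≡cardL n = begin
    (2 ^ n ℕ.+ 1) ℕ.* (2 ^ n ℕ.+ 2) ℕ./ 6
  ≡⟨ cong (ℕ._/ 6) (trans (sym (6*countRG-1 n)) (*-comm 6 (countRG 1 n))) ⟩
    countRG 1 n ℕ.* 6 ℕ./ 6
  ≡⟨ m*n/n≡m (countRG 1 n) 6 ⟩
    countRG 1 n ∎

6*g : ∀ n → 6 ℕ.* g n ≡ (2 ^ n ℕ.+ 1) ℕ.* (2 ^ n ℕ.+ 2)
6*g n = trans (cong (6 ℕ.*_) (g≡cardL n)) (6*countRG-1 n)

g-recurrence : ∀ k → 6 ℕ.* g (suc k) ℕ.+ 1 ≡ 8 ℕ.* g k ℕ.+ g (suc (suc k))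
g-recurrence k = *-cancelˡ-≡ _ _ 6 (begin
    6 ℕ.* (6 ℕ.* g (suc k) ℕ.+ 1)
  ≡⟨ cong (λ a → 6 ℕ.* (a ℕ.+ 1)) (6*g (suc k)) ⟩
    6 ℕ.* ((2 ℕ.* y ℕ.+ 1) ℕ.* (2 ℕ.* y ℕ.+ 2) ℕ.+ 1)
  ≡⟨ polynomial-identity y ⟩
    8 ℕ.* ((y ℕ.+ 1) ℕ.* (y ℕ.+ 2)) ℕ.+ (2 ℕ.* (2 ℕ.* y) ℕ.+ 1) ℕ.* (2 ℕ.* (2 ℕ.* y) ℕ.+ 2)
  ≡⟨ cong₂ (λ a b → 8 ℕ.* a ℕ.+ b) (sym (6*g k)) (sym (6*g (suc (suc k)))) ⟩
    8 ℕ.* (6 ℕ.* g k) ℕ.+ 6 ℕ.* g (suc (suc k))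
  ≡⟨ factor-6 (g k) (g (suc (suc k))) ⟩
    6 ℕ.* (8 ℕ.* g k ℕ.+ g (suc (suc k))) ∎)
  where
  y : ℕ
  y = 2 ^ k
  polynomial-identity : ∀ y → 6 ℕ.* ((2 ℕ.* y ℕ.+ 1) ℕ.* (2 ℕ.* y ℕ.+ 2) ℕ.+ 1)
    ≡ 8 ℕ.* ((y ℕ.+ 1) ℕ.* (y ℕ.+ 2)) ℕ.+ (2 ℕ.* (2 ℕ.* y) ℕ.+ 1) ℕ.* (2 ℕ.* (2 ℕ.* y) ℕ.+ 2)
  polynomial-identity = solve-∀
  factor-6 : ∀ a b → 8 ℕ.* (6 ℕ.* a) ℕ.+ 6 ℕ.* b ≡ 6 ℕ.* (8 ℕ.* a ℕ.+ b)
  factor-6 = solve-∀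

three-term-identity : ∀ {a b c : ℤ} → + 6 * a + + 1 ≡ + 8 * b + c →
  + 2 * a + + 4 * (a - + 2 * b) + + 1 ≡ c
three-term-identity {a} {b} {c} eq = begin
    + 2 * a + + 4 * (a - + 2 * b) + + 1
  ≡⟨ regroup a b ⟩
    (+ 6 * a + + 1) - + 8 * b
  ≡⟨ cong (_- + 8 * b) eq ⟩
    (+ 8 * b + c) - + 8 * b
  ≡⟨ cancel b c ⟩
    c ∎
  where
  regroup : ∀ a b → + 2 * a + + 4 * (a - + 2 * b) + + 1 ≡ (+ 6 * a + + 1) - + 8 * b
  regroup = ℤ-Solver.solve-∀
  cancel : ∀ b c → (+ 8 * b + c) - + 8 * b ≡ c
  cancel = ℤ-Solver.solve-∀

pos-*-+ : ∀ k m n → + (k ℕ.* m ℕ.+ n) ≡ + k * + m + + n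
pos-*-+ k m n = trans (pos-+ (k ℕ.* m) n) (cong (_+ + n) (pos-* k m))

g-three-term : ∀ k →
  + 2 * + g (suc k) + + 4 * (+ g (suc k) - + 2 * + g k) + + 1 ≡ + g (suc (suc k))
g-three-term k = three-term-identity {+ g (suc k)} {+ g k} (begin
    + 6 * + g (suc k) + + 1
  ≡⟨ pos-*-+ 6 (g (suc k)) 1 ⟨
    + (6 ℕ.* g (suc k) ℕ.+ 1)
  ≡⟨ cong +_ (g-recurrence k) ⟩
    + (8 ℕ.* g k ℕ.+ g (suc (suc k)))
  ≡⟨ pos-*-+ 8 (g k) (g (suc (suc k))) ⟩
    + 8 * + g k + + g (suc (suc k)) ∎)

mainTheorem4 : (n : ℕ) → 2 ≤ n →
    (+ cardL n ≡ + 2 * + g (Data.Nat._∸_ n 1) + + 4 * (+ g (Data.Nat._∸_ n 1) - + 2 * + g (Data.Nat._∸_ n 2)) + + 1)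
    × (+ 2 * + g (Data.Nat._∸_ n 1) + + 4 * (+ g (Data.Nat._∸_ n 1) - + 2 * + g (Data.Nat._∸_ n 2)) + + 1 ≡ + g n)
mainTheorem4 (suc zero) (s≤s ())
mainTheorem4 (suc (suc k)) _ =
  trans (cong +_ (sym (g≡cardL (suc (suc k))))) (sym (g-three-term k)) , g-three-term k
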